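{- Let $h\ge 4$ and let $G$ be a connected graph with $\chi(G)=\Gamma(G)=3$, $\psi(G)=h$ and exactly $2h-2$ vertices. Let $\mathcal H$ be a complete $h$-coloring of $G$ having exactly two singleton color classes and $h-2$ color classes of size two (called pairs), and let $M$ be the union of the pairs. Then exactly two pairs contain a vertex that is isolated in the induced subgraph $G[M]$.
   Context: A complete $k$-coloring of a graph is a proper coloring with exactly $k$ colors in which any two color classes are joined by at least one edge; $\psi$ (achromatic number) is the maximum such $k$, $\chi$ is the chromatic number. A Grundy coloring is a proper coloring $\varphi:V\to\{1,\dots,k\}$ in which every vertex $v$ has a neighbor of color $i$ for every $1\le i<\varphi(v)$; the Grundy number $\Gamma$ is the maximum $k$ for which such a coloring exists. -}

module Defs where

open import Data.Nat using (ℕ; zero; suc; _<_; _≤_; _+_; _*_; _∸_)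
open import Data.Fin using (Fin; toℕ; _≟_)
open import Data.List using (List; length; filter; allFin)
open import Data.Product using (Σ; ∃; ∃-syntax; _×_; _,_)
open import Data.Sum using (_⊎_)
open import Relation.Nullary using (¬_; Dec)
open import Relation.Binary.PropositionalEquality using (_≡_; _≢_)

record Graph : Set₁ where
  field
    n      : ℕ
    Adj    : Fin n → Fin n → Set
    sym    : ∀ {u v} → Adj u v → Adj v u
    irrefl : ∀ {v} → ¬ Adj v v
    dec    : ∀ u v → Dec (Adj u v)

open Graph public

Vertex : Graph → Set
Vertex G = Fin (n G)

data Reach (G : Graph) : Vertex G → Vertex G → Set where
  here : ∀ {v} → Reach G v v
  step : ∀ {u w v} → Adj G u w → Reach G w v → Reach G u v

Connected : Graph → Set
Connected G = ∀ u v → Reach G u v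

-- a coloring with colors Fin k (i.e. {1,…,k})
Coloring : Graph → ℕ → Set
Coloring G k = Vertex G → Fin k

Proper : (G : Graph) {k : ℕ} → Coloring G k → Set
Proper G c = ∀ {u v} → Adj G u v → c u ≢ c v

UsesAll : (G : Graph) {k : ℕ} → Coloring G k → Set
UsesAll G {k} c = ∀ (i : Fin k) → ∃[ v ] (c v ≡ i)

IsComplete : (G : Graph) {k : ℕ} → Coloring G k → Set
IsComplete G {k} c =
  Proper G c × UsesAll G c ×
  (∀ (i j : Fin k) → i ≢ j →
     ∃[ u ] ∃[ v ] (c u ≡ i × c v ≡ j × Adj G u v))

IsGrundy : (G : Graph) {k : ℕ} → Coloring G k → Set
IsGrundy G {k} c =
  Proper G c × UsesAll G c ×
  (∀ v (i : Fin k) → toℕ i < toℕ (c v) → ∃[ u ] (Adj G v u × c u ≡ i))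

ChromaticNumber : Graph → ℕ → Set
ChromaticNumber G k =
  (Σ (Coloring G k) λ c → Proper G c) ×
  (∀ m → m < k → ¬ (Σ (Coloring G m) λ c → Proper G c))

GrundyNumber : Graph → ℕ → Set
GrundyNumber G k =
  (Σ (Coloring G k) λ c → IsGrundy G c) ×
  (∀ m → k < m → ¬ (Σ (Coloring G m) λ c → IsGrundy G c))

AchromaticNumber : Graph → ℕ → Set
AchromaticNumber G k =
  (Σ (Coloring G k) λ c → IsComplete G c) ×
  (∀ m → k < m → ¬ (Σ (Coloring G m) λ c → IsComplete G c))

classSize : (G : Graph) {k : ℕ} → Coloring G k → Fin k → ℕ
classSize G c i = length (filter (λ v → c v ≟ i) (allFin (n G)))

ExactlyTwo : {A : Set} → (A → Set) → Set
ExactlyTwo {A} P =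
  ∃[ a ] ∃[ b ] (a ≢ b × P a × P b × (∀ x → P x → x ≡ a ⊎ x ≡ b))

InM : (G : Graph) {k : ℕ} → Coloring G k → Vertex G → Set
InM G c v = classSize G c (c v) ≡ 2

IsolatedInM : (G : Graph) {k : ℕ} → Coloring G k → Vertex G → Set
IsolatedInM G c v = InM G c v × (∀ u → InM G c u → ¬ Adj G v u)

module Submission where

-- Only connectivity, Γ(G) ≤ 3, h ≥ 4 and the shape of c are needed.
--
-- Every contradiction comes from one principle: G has no partial Grundy
-- 4-colouring, since by first fit it would extend to a Grundy colouring with at
-- least four colours.  For the given colouring it lists forbidden configurations and
-- concludes: the non-isolated vertices of three type-I pairs would form a
-- triangle that can neither see a fourth pair nor touch a or b (at most two);
-- the type-II pairs are split between a and b and ordered by a transitive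
-- tournament whose source and sink reach two different type-I pairs (at least two).

open import Defs renaming (sym to adj-sym)
open import Data.Nat using (ℕ; zero; suc; _+_; _*_; _∸_; _≤_; _<_; z≤n; s≤s)
import Data.Nat as ℕ
open import Data.Nat.Properties
  using (≤-refl; ≤-trans; ≤-reflexive; n≤1+n; <-irrefl; <⇒≱; <⇒≢; ≤∧≢⇒<; ≮⇒≥; _<?_; +-identityʳ; +-suc; +-comm;
         m∸n+n≡m; n≢0⇒n>0; suc-injective)
open import Data.Fin using (Fin; toℕ; fromℕ<; _≟_)
open import Data.Fin.Properties using (toℕ-fromℕ<; toℕ-injective; toℕ<n; pigeonhole; any?; all?; ¬∀⟶∃¬)
open import Data.List using (List; []; _∷_; length; map; filter; allFin; lookup)
open import Data.List.Extrema.Nat using (max; xs≤max; argmax; f[xs]≤f[argmax])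
open import Data.List.Membership.Propositional using (_∈_; _∉_)
open import Data.List.Membership.Propositional.Properties using (∈-filter⁺; ∈-filter⁻; ∈-map⁺; ∈-map⁻; ∈-allFin)
open import Data.List.Membership.DecPropositional ℕ._≟_ using (_∈?_)
import Data.List.Relation.Unary.All as All
open import Data.List.Relation.Unary.All using ([]; _∷_)
import Data.List.Relation.Unary.Any as Any
open import Data.List.Relation.Unary.Any using (here; there; index)
open import Data.List.Relation.Unary.Any.Properties using (lookup-index)
open import Data.List.Relation.Unary.AllPairs using (_∷_)
open import Data.List.Relation.Unary.Unique.Propositional using (Unique)
open import Data.List.Relation.Unary.Unique.Propositional.Properties using (allFin⁺; filter⁺)
open import Data.Product using (Σ; ∃-syntax; _×_; _,_; proj₁; proj₂)
open import Data.Sum using (_⊎_; inj₁; inj₂; swap)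
import Data.Sum as Sum
open import Data.Empty using (⊥; ⊥-elim)
open import Function using (id; _∘_)
open import Relation.Nullary using (¬_; Dec; yes; no; contradiction)
open import Relation.Nullary.Decidable using (_×-dec_; _⊎-dec_; _→-dec_; ¬?; decidable-stable)
open import Relation.Unary using (Decidable)
open import Relation.Binary.PropositionalEquality using (_≡_; _≢_; refl; sym; trans; cong; subst)

-- Minimum excluded value.  mex xs is the least positive number not in xs;
-- it is what the first-fit rule assigns to a vertex whose neighbours carry xs.
module Mex where

  scan : List ℕ → ℕ → ℕ → ℕ
  scan xs zero    j = j
  scan xs (suc f) j with j ∈? xs
  ... | yes _ = scan xs f (suc j)
  ... | no  _ = j

  scan-≥ : ∀ xs f j → j ≤ scan xs f j
  scan-≥ xs zero    j = ≤-refl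
  scan-≥ xs (suc f) j with j ∈? xs
  ... | yes _ = ≤-trans (n≤1+n j) (scan-≥ xs f (suc j))
  ... | no  _ = ≤-refl

  scan-skips : ∀ xs f j k → j ≤ k → k < scan xs f j → k ∈ xs
  scan-skips xs zero    j k j≤k k<s = contradiction j≤k (<⇒≱ k<s)
  scan-skips xs (suc f) j k j≤k k<s with j ∈? xs
  ... | no _ = contradiction j≤k (<⇒≱ k<s)
  ... | yes j∈xs with j ℕ.≟ k
  ...   | yes refl = j∈xs
  ...   | no j≢k  = scan-skips xs f (suc j) k (≤∧≢⇒< j≤k j≢k) k<s

  scan-∉ : ∀ xs f j → max 0 xs < j + f → scan xs f j ∉ xs
  scan-∉ xs zero    j lt j∈xs =
    <-irrefl refl (≤-trans (subst (max 0 xs <_) (+-identityʳ j) lt) (All.lookup (xs≤max 0 xs) j∈xs))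
  scan-∉ xs (suc f) j lt p with j ∈? xs
  ... | no  j∉xs = j∉xs p
  ... | yes _    = scan-∉ xs f (suc j) (subst (max 0 xs <_) (+-suc j f) lt) p

  mex : List ℕ → ℕ
  mex xs = scan xs (suc (max 0 xs)) 1

  mex-positive : ∀ xs → 1 ≤ mex xs
  mex-positive xs = scan-≥ xs (suc (max 0 xs)) 1

  mex-∉ : ∀ xs → mex xs ∉ xs
  mex-∉ xs = scan-∉ xs (suc (max 0 xs)) 1 (s≤s (n≤1+n _))

  mex-minimal : ∀ xs k → 1 ≤ k → k < mex xs → k ∈ xs
  mex-minimal xs k = scan-skips xs (suc (max 0 xs)) 1 k

open Mex using (mex; mex-positive; mex-∉; mex-minimal)

-- L labels some vertices
-- with positive numbers (0 = unlabelled) so that equal labels are never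
-- adjacent and a vertex labelled k has neighbours labelled 1, …, k-1.
-- Processing the vertices in the order of Fin and giving each unlabelled one
-- the mex of its neighbours' current values yields a Grundy colouring F that
-- agrees with L on labelled vertices.
module FirstFit (G : Graph) (L : Vertex G → ℕ)
  (label-proper : ∀ {u v} → Adj G u v → L u ≡ L v → L u ≡ 0)
  (label-grundy : ∀ v i → 1 ≤ i → i < L v → ∃[ u ] (Adj G v u × L u ≡ i))
  where

  V : Set
  V = Vertex G

  neighbours : V → List V
  neighbours v = filter (dec G v) (allFin (n G))

  neighbourValues : V → (V → ℕ) → List ℕ
  neighbourValues v f = map f (neighbours v)

  process : ℕ → (V → ℕ) → V → ℕ
  process k f u with toℕ u ℕ.≟ k | L u ℕ.≟ 0
  ... | yes _ | yes _ = mex (neighbourValues u f)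
  ... | yes _ | no _  = f u
  ... | no _  | _     = f u

  stage : ℕ → V → ℕ
  stage zero    = L
  stage (suc k) = process k (stage k)

  F : V → ℕ
  F = stage (n G)

  -- the values visible at the moment u is processed
  seenBy : V → V → ℕ
  seenBy u = stage (toℕ u)

  process-other : ∀ k f u → toℕ u ≢ k → process k f u ≡ f u
  process-other k f u ne with toℕ u ℕ.≟ k
  ... | yes e = contradiction e ne
  ... | no _  = refl

  stage-before : ∀ k u → k ≤ toℕ u → stage k u ≡ L u
  stage-before zero    u _  = refl
  stage-before (suc k) u le =
    trans (process-other k (stage k) u (λ e → <-irrefl (sym e) le))
          (stage-before k u (≤-trans (n≤1+n k) le))

  stage-after : ∀ j u → toℕ u < j → stage j u ≡ stage (suc (toℕ u)) u
  stage-after (suc j) u (s≤s le) = by-cases (toℕ u ℕ.≟ j)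
    where
    by-cases : Dec (toℕ u ≡ j) → stage (suc j) u ≡ stage (suc (toℕ u)) u
    by-cases (yes e) = cong (λ k → stage (suc k) u) (sym e)
    by-cases (no ne) = trans (process-other j (stage j) u ne) (stage-after j u (≤∧≢⇒< le ne))

  F-process : ∀ u → F u ≡ process (toℕ u) (seenBy u) u
  F-process u = stage-after (n G) u (toℕ<n u)

  F-labelled : ∀ u → L u ≢ 0 → F u ≡ L u
  F-labelled u ne = trans (F-process u) processed
    where
    processed : process (toℕ u) (seenBy u) u ≡ L u
    processed with toℕ u ℕ.≟ toℕ u | L u ℕ.≟ 0
    ... | _     | yes e = contradiction e ne
    ... | yes _ | no _  = stage-before (toℕ u) u ≤-refl
    ... | no x  | no _  = contradiction refl x

  F-unlabelled : ∀ u → L u ≡ 0 → F u ≡ mex (neighbourValues u (seenBy u))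
  F-unlabelled u e = trans (F-process u) processed
    where
    processed : process (toℕ u) (seenBy u) u ≡ mex (neighbourValues u (seenBy u))
    processed with toℕ u ℕ.≟ toℕ u | L u ℕ.≟ 0
    ... | yes _ | yes _ = refl
    ... | yes _ | no x  = contradiction e x
    ... | no x  | _     = contradiction refl x

  F-positive : ∀ u → 1 ≤ F u
  F-positive u with L u ℕ.≟ 0
  ... | yes e = subst (1 ≤_) (sym (F-unlabelled u e)) (mex-positive (neighbourValues u (seenBy u)))
  ... | no ne = subst (1 ≤_) (sym (F-labelled u ne)) (n≢0⇒n>0 ne)

  L≤F : ∀ u → L u ≤ F u
  L≤F u with L u ℕ.≟ 0
  ... | yes e = subst (_≤ F u) (sym e) z≤n
  ... | no ne = ≤-reflexive (sym (F-labelled u ne))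

  seen-final : ∀ u w → toℕ w < toℕ u → seenBy u w ≡ F w
  seen-final u w lt = trans (stage-after (toℕ u) w lt) (sym (stage-after (n G) w (toℕ<n w)))

  seen-cases : ∀ u w → (seenBy u w ≡ F w) ⊎ (seenBy u w ≡ 0 × L w ≡ 0 × toℕ u ≤ toℕ w)
  seen-cases u w with toℕ w <? toℕ u
  ... | yes lt = inj₁ (seen-final u w lt)
  ... | no nlt with L w ℕ.≟ 0
  ...   | yes e = inj₂ (trans (stage-before (toℕ u) w (≮⇒≥ nlt)) e , e , ≮⇒≥ nlt)
  ...   | no ne = inj₁ (trans (stage-before (toℕ u) w (≮⇒≥ nlt)) (sym (F-labelled w ne)))

  seen-neighbour : ∀ u w → Adj G u w → seenBy u w ∈ neighbourValues u (seenBy u)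
  seen-neighbour u w a = ∈-map⁺ (seenBy u) (∈-filter⁺ (dec G u) (∈-allFin w) a)

  avoids-seen : ∀ u w → Adj G u w → L u ≡ 0 → seenBy u w ≡ F w → F u ≢ F w
  avoids-seen u w a lu seen eq =
    mex-∉ (neighbourValues u (seenBy u)) (subst (_∈ neighbourValues u (seenBy u)) (trans seen (trans (sym eq) (F-unlabelled u lu)))
                   (seen-neighbour u w a))

  F-proper-unlabelled : ∀ u w → Adj G u w → L u ≡ 0 → F u ≢ F w
  F-proper-unlabelled u w a lu with seen-cases u w
  ... | inj₁ seen = avoids-seen u w a lu seen
  ... | inj₂ (_ , lw , le) =
    λ eq → avoids-seen w u (adj-sym G a) lw (seen-final w u (≤∧≢⇒< le u≢w)) (sym eq)
    where
    u≢w : toℕ u ≢ toℕ w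
    u≢w e = irrefl G (subst (Adj G u) (sym (toℕ-injective e)) a)

  F-proper : ∀ u w → Adj G u w → F u ≢ F w
  F-proper u w a with L u ℕ.≟ 0 | L w ℕ.≟ 0
  ... | yes lu | _      = F-proper-unlabelled u w a lu
  ... | no _   | yes lw = λ eq → F-proper-unlabelled w u (adj-sym G a) lw (sym eq)
  ... | no lu  | no lw  =
    λ eq → lu (label-proper a (trans (sym (F-labelled u lu)) (trans eq (F-labelled w lw))))

  F-grundy : ∀ v j → 1 ≤ j → j < F v → ∃[ u ] (Adj G v u × F u ≡ j)
  F-grundy v j j≥1 j<Fv with L v ℕ.≟ 0
  ... | no lv with label-grundy v j j≥1 (subst (j <_) (F-labelled v lv) j<Fv)
  ...   | u , a , lu = u , a , trans (F-labelled u (λ z → <⇒≢ j≥1 (sym (trans (sym lu) z)))) lu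
  F-grundy v j j≥1 j<Fv | yes lv
    with ∈-map⁻ (seenBy v) (mex-minimal (neighbourValues v (seenBy v)) j j≥1 (subst (j <_) (F-unlabelled v lv) j<Fv))
  ... | w , w∈ , j≡ with ∈-filter⁻ (dec G v) {xs = allFin (n G)} w∈
  ...   | _ , a with seen-cases v w
  ...     | inj₁ seen = w , a , trans (sym seen) (sym j≡)
  ...     | inj₂ (z , _ , _) = contradiction (sym (trans j≡ z)) (<⇒≢ j≥1)

  -- shift the positive values of F to colours Fin m, m the largest value
  grundyExtension : ∀ t → Σ ℕ λ m → L t ≤ m × Σ (Coloring G m) λ c → IsGrundy G c
  grundyExtension t = m , ≤-trans (L≤F t) (F≤m t) , colour , proper , usesAll , grundy
    where
    top : V
    top = argmax F t (allFin (n G))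
    m : ℕ
    m = F top
    F≤m : ∀ v → F v ≤ m
    F≤m v = All.lookup (f[xs]≤f[argmax] {f = F} t (allFin (n G))) (∈-allFin v)
    F-pred : ∀ v → suc (F v ∸ 1) ≡ F v
    F-pred v = trans (+-comm 1 (F v ∸ 1)) (m∸n+n≡m (F-positive v))
    bound : ∀ v → F v ∸ 1 < m
    bound v = subst (_≤ m) (sym (F-pred v)) (F≤m v)
    colour : Coloring G m
    colour v = fromℕ< (bound v)
    toℕ-colour : ∀ v → suc (toℕ (colour v)) ≡ F v
    toℕ-colour v = trans (cong suc (toℕ-fromℕ< (bound v))) (F-pred v)
    colour-of : ∀ u (i : Fin m) → F u ≡ suc (toℕ i) → colour u ≡ i
    colour-of u i e = toℕ-injective (suc-injective (trans (toℕ-colour u) e))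
    proper : Proper G colour
    proper {u} {v} a eq = F-proper u v a (trans (sym (toℕ-colour u)) (trans (cong (suc ∘ toℕ) eq) (toℕ-colour v)))
    grundy : ∀ v (i : Fin m) → toℕ i < toℕ (colour v) → ∃[ u ] (Adj G v u × colour u ≡ i)
    grundy v i lt with F-grundy v (suc (toℕ i)) (s≤s z≤n) (subst (suc (toℕ i) <_) (toℕ-colour v) (s≤s lt))
    ... | u , a , e = u , a , colour-of u i e
    usesAll : UsesAll G colour
    usesAll i with suc (toℕ i) ℕ.≟ m
    ... | yes e = top , colour-of top i (sym e)
    ... | no ne with F-grundy top (suc (toℕ i)) (s≤s z≤n) (≤∧≢⇒< (toℕ<n i) ne)
    ...   | u , _ , e = u , colour-of u i e

-- Γ(G) ≤ 3: the only half of Γ(G) = 3 that the argument uses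
GrundyAtMost3 : Graph → Set
GrundyAtMost3 G = ∀ m → 3 < m → ¬ Σ (Coloring G m) λ c → IsGrundy G c

-- Every forbidden configuration in the proof is exhibited as one of these.
record PartialGrundy4 (G : Graph) : Set₁ where
  field
    K₁ K₂ K₃ K₄ : Vertex G → Set
    K₁? : Decidable K₁
    K₂? : Decidable K₂
    K₃? : Decidable K₃
    K₄? : Decidable K₄
    indep₁ : ∀ {u v} → K₁ u → K₁ v → ¬ Adj G u v
    indep₂ : ∀ {u v} → K₂ u → K₂ v → ¬ Adj G u v
    indep₃ : ∀ {u v} → K₃ u → K₃ v → ¬ Adj G u v
    indep₄ : ∀ {u v} → K₄ u → K₄ v → ¬ Adj G u v
    disj₁₂ : ∀ {v} → K₁ v → K₂ v → ⊥
    disj₁₃ : ∀ {v} → K₁ v → K₃ v → ⊥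
    disj₁₄ : ∀ {v} → K₁ v → K₄ v → ⊥
    disj₂₃ : ∀ {v} → K₂ v → K₃ v → ⊥
    disj₂₄ : ∀ {v} → K₂ v → K₄ v → ⊥
    disj₃₄ : ∀ {v} → K₃ v → K₄ v → ⊥
    dom₂₁ : ∀ {v} → K₂ v → ∃[ u ] (K₁ u × Adj G v u)
    dom₃₁ : ∀ {v} → K₃ v → ∃[ u ] (K₁ u × Adj G v u)
    dom₃₂ : ∀ {v} → K₃ v → ∃[ u ] (K₂ u × Adj G v u)
    dom₄₁ : ∀ {v} → K₄ v → ∃[ u ] (K₁ u × Adj G v u)
    dom₄₂ : ∀ {v} → K₄ v → ∃[ u ] (K₂ u × Adj G v u)
    dom₄₃ : ∀ {v} → K₄ v → ∃[ u ] (K₃ u × Adj G v u)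
    top : ∃[ v ] K₄ v

module Labelling {G : Graph} (P : PartialGrundy4 G) where
  open PartialGrundy4 P

  level : ℕ → Vertex G → Set
  level 1 = K₁
  level 2 = K₂
  level 3 = K₃
  level 4 = K₄
  level _ = λ _ → ⊥

  label : Vertex G → ℕ
  label v with K₄? v | K₃? v | K₂? v | K₁? v
  ... | yes _ | _     | _     | _     = 4
  ... | no _  | yes _ | _     | _     = 3
  ... | no _  | no _  | yes _ | _     = 2
  ... | no _  | no _  | no _  | yes _ = 1
  ... | no _  | no _  | no _  | no _  = 0

  label-level : ∀ v → level (label v) v ⊎ label v ≡ 0
  label-level v with K₄? v | K₃? v | K₂? v | K₁? v
  ... | yes k | _     | _     | _     = inj₁ k
  ... | no _  | yes k | _     | _     = inj₁ k
  ... | no _  | no _  | yes k | _     = inj₁ k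
  ... | no _  | no _  | no _  | yes k = inj₁ k
  ... | no _  | no _  | no _  | no _  = inj₂ refl

  level-label : ∀ i u → level i u → label u ≡ i
  level-label 1 u k with K₄? u | K₃? u | K₂? u | K₁? u
  ... | yes k₄ | _      | _      | _      = ⊥-elim (disj₁₄ k k₄)
  ... | no _   | yes k₃ | _      | _      = ⊥-elim (disj₁₃ k k₃)
  ... | no _   | no _   | yes k₂ | _      = ⊥-elim (disj₁₂ k k₂)
  ... | no _   | no _   | no _   | yes _  = refl
  ... | no _   | no _   | no _   | no ¬k  = contradiction k ¬k
  level-label 2 u k with K₄? u | K₃? u | K₂? u
  ... | yes k₄ | _      | _     = ⊥-elim (disj₂₄ k k₄)
  ... | no _   | yes k₃ | _     = ⊥-elim (disj₂₃ k k₃)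
  ... | no _   | no _   | yes _ = refl
  ... | no _   | no _   | no ¬k = contradiction k ¬k
  level-label 3 u k with K₄? u | K₃? u
  ... | yes k₄ | _     = ⊥-elim (disj₃₄ k k₄)
  ... | no _   | yes _ = refl
  ... | no _   | no ¬k = contradiction k ¬k
  level-label 4 u k with K₄? u
  ... | yes _ = refl
  ... | no ¬k = contradiction k ¬k

  level-indep : ∀ i {u v} → level i u → level i v → ¬ Adj G u v
  level-indep 1 = indep₁
  level-indep 2 = indep₂
  level-indep 3 = indep₃
  level-indep 4 = indep₄

  level-dom : ∀ k i {v} → 1 ≤ i → i < k → level k v → ∃[ u ] (level i u × Adj G v u)
  level-dom 2 1 _ _ = dom₂₁
  level-dom 3 1 _ _ = dom₃₁
  level-dom 3 2 _ _ = dom₃₂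
  level-dom 4 1 _ _ = dom₄₁
  level-dom 4 2 _ _ = dom₄₂
  level-dom 4 3 _ _ = dom₄₃
  level-dom 1 1 _ (s≤s ())
  level-dom 2 2 _ (s≤s (s≤s ()))
  level-dom 3 3 _ (s≤s (s≤s (s≤s ())))
  level-dom 4 4 _ (s≤s (s≤s (s≤s (s≤s ()))))

  label-proper : ∀ {u v} → Adj G u v → label u ≡ label v → label u ≡ 0
  label-proper {u} {v} a e with label-level u | label-level v
  ... | inj₂ z  | _       = z
  ... | inj₁ _  | inj₂ z  = trans e z
  ... | inj₁ ku | inj₁ kv = ⊥-elim (level-indep (label u) ku (subst (λ k → level k v) (sym e) kv) a)

  label-grundy : ∀ v i → 1 ≤ i → i < label v → ∃[ u ] (Adj G v u × label u ≡ i)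
  label-grundy v i i≥1 i<l with label-level v
  ... | inj₂ z rewrite z = contradiction i<l λ ()
  ... | inj₁ k with level-dom (label v) i i≥1 i<l k
  ...   | u , ku , a = u , a , level-label i u ku

-- A partial Grundy 4-colouring extends by first fit to a Grundy colouring
-- with at least four colours, so it cannot exist when Γ(G) ≤ 3.
noPartialGrundy4 : (G : Graph) → GrundyAtMost3 G → PartialGrundy4 G → ⊥
noPartialGrundy4 G Γ≤3 P = use-top (PartialGrundy4.top P)
  where
  open Labelling P
  use-top : ∃[ t ] PartialGrundy4.K₄ P t → ⊥
  use-top (t , t∈K₄) = conclude (FirstFit.grundyExtension G label label-proper label-grundy t)
    where
    conclude : (Σ ℕ λ m → label t ≤ m × Σ (Coloring G m) λ c → IsGrundy G c) → ⊥
    conclude (m , label≤m , grundy) = Γ≤3 m (subst (_≤ m) (level-label 4 t t∈K₄) label≤m) grundy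

-- The simplest instance: a K₄ is a partial Grundy 4-colouring.
noK4 : (G : Graph) → GrundyAtMost3 G → ∀ {w₁ w₂ w₃ w₄} →
  Adj G w₁ w₂ → Adj G w₁ w₃ → Adj G w₁ w₄ → Adj G w₂ w₃ → Adj G w₂ w₄ → Adj G w₃ w₄ → ⊥
noK4 G Γ≤3 {w₁} {w₂} {w₃} {w₄} a₁₂ a₁₃ a₁₄ a₂₃ a₂₄ a₃₄ = noPartialGrundy4 G Γ≤3 (record
  { K₁ = _≡ w₁ ; K₂ = _≡ w₂ ; K₃ = _≡ w₃ ; K₄ = _≡ w₄
  ; K₁? = _≟ w₁ ; K₂? = _≟ w₂ ; K₃? = _≟ w₃ ; K₄? = _≟ w₄
  ; indep₁ = λ { refl refl → irrefl G } ; indep₂ = λ { refl refl → irrefl G }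
  ; indep₃ = λ { refl refl → irrefl G } ; indep₄ = λ { refl refl → irrefl G }
  ; disj₁₂ = λ { refl refl → irrefl G a₁₂ } ; disj₁₃ = λ { refl refl → irrefl G a₁₃ }
  ; disj₁₄ = λ { refl refl → irrefl G a₁₄ } ; disj₂₃ = λ { refl refl → irrefl G a₂₃ }
  ; disj₂₄ = λ { refl refl → irrefl G a₂₄ } ; disj₃₄ = λ { refl refl → irrefl G a₃₄ }
  ; dom₂₁ = λ { refl → w₁ , refl , adj-sym G a₁₂ }
  ; dom₃₁ = λ { refl → w₁ , refl , adj-sym G a₁₃ } ; dom₃₂ = λ { refl → w₂ , refl , adj-sym G a₂₃ }
  ; dom₄₁ = λ { refl → w₁ , refl , adj-sym G a₁₄ } ; dom₄₂ = λ { refl → w₂ , refl , adj-sym G a₂₄ }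
  ; dom₄₃ = λ { refl → w₃ , refl , adj-sym G a₃₄ }
  ; top = w₄ , refl })

module ColourClasses (G : Graph) {k : ℕ} (c : Coloring G k) where

  classList : Fin k → List (Vertex G)
  classList i = filter (λ v → c v ≟ i) (allFin (n G))

  ∈-class : ∀ i w → c w ≡ i → w ∈ classList i
  ∈-class i w e = ∈-filter⁺ (λ v → c v ≟ i) (∈-allFin w) e

  class-∈ : ∀ i w → w ∈ classList i → c w ≡ i
  class-∈ i w p = proj₂ (∈-filter⁻ (λ v → c v ≟ i) {xs = allFin (n G)} p)

  class-unique : ∀ i → Unique (classList i)
  class-unique i = filter⁺ (λ v → c v ≟ i) (allFin⁺ (n G))

  singletonClass : ∀ i → classSize G c i ≡ 1 → ∃[ u ] (c u ≡ i × (∀ w → c w ≡ i → w ≡ u))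
  singletonClass i size = listed (classList i) size (∈-class i) (class-∈ i)
    where
    listed : ∀ xs → length xs ≡ 1 → (∀ w → c w ≡ i → w ∈ xs) → (∀ w → w ∈ xs → c w ≡ i) →
             ∃[ u ] (c u ≡ i × (∀ w → c w ≡ i → w ≡ u))
    listed (u ∷ []) _ to from = u , from u (here refl) , λ w e → only (to w e)
      where only : ∀ {w} → w ∈ u ∷ [] → w ≡ u
            only (here p) = p

  pairClass : ∀ i → classSize G c i ≡ 2 →
    ∃[ u ] ∃[ v ] (u ≢ v × c u ≡ i × c v ≡ i × (∀ w → c w ≡ i → w ≡ u ⊎ w ≡ v))
  pairClass i size = listed (classList i) size (class-unique i) (∈-class i) (class-∈ i)
    where
    listed : ∀ xs → length xs ≡ 2 → Unique xs → (∀ w → c w ≡ i → w ∈ xs) → (∀ w → w ∈ xs → c w ≡ i) →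
             ∃[ u ] ∃[ v ] (u ≢ v × c u ≡ i × c v ≡ i × (∀ w → c w ≡ i → w ≡ u ⊎ w ≡ v))
    listed (u ∷ v ∷ []) _ ((u≢v ∷ []) ∷ _) to from =
      u , v , u≢v , from u (here refl) , from v (there (here refl)) , λ w e → only (to w e)
      where only : ∀ {w} → w ∈ u ∷ v ∷ [] → w ≡ u ⊎ w ≡ v
            only (here p)         = inj₁ p
            only (there (here p)) = inj₂ p

missing : ∀ {h} (xs : List (Fin h)) → length xs < h → ∃[ z ] (z ∉ xs)
missing {h} xs short with all? (λ z → Any.any? (z ≟_) xs)
... | no ¬all = ¬∀⟶∃¬ h _ (λ z → Any.any? (z ≟_) xs) ¬all
... | yes all with pigeonhole short (λ z → index (all z))
...   | i , j , i<j , same = contradiction (cong toℕ i≡j) (<⇒≢ i<j)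
  where
  i≡j : i ≡ j
  i≡j = trans (lookup-index (all i)) (trans (cong (lookup xs) same) (sym (lookup-index (all j))))

leavingEdge : ∀ {G : Graph} {u v} (T : Vertex G → Set) → (∀ x → Dec (T x)) →
  Reach G u v → T u → ¬ T v → ∃[ p ] ∃[ q ] (T p × ¬ T q × Adj G p q)
leavingEdge T T? here        tu ¬tv = contradiction tu ¬tv
leavingEdge T T? (step {u} {w} a walk) tu ¬tv with T? w
... | yes tw = leavingEdge T T? walk tw ¬tv
... | no ¬tw = u , w , tu , ¬tw , a

module Tournament {h : ℕ} (T : Fin h → Set) (T? : ∀ i → Dec (T i)) (_⇒_ : Fin h → Fin h → Set)
  (total : ∀ P R → T P → T R → P ≢ R → P ⇒ R ⊎ R ⇒ P)
  (transitive : ∀ P R S → T P → T R → T S → P ≢ R → R ≢ S → P ≢ S → P ⇒ R → R ⇒ S → P ⇒ S)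
  where

  sourceOf : ∀ (xs : List (Fin h)) m₀ → T m₀ → ∃[ m ] (T m × (∀ R → R ∈ xs → T R → R ≢ m → m ⇒ R))
  sourceOf []       m₀ t₀ = m₀ , t₀ , λ R ()
  sourceOf (y ∷ ys) m₀ t₀ with sourceOf ys m₀ t₀
  ... | m , tm , beats with T? y | y ≟ m
  ...   | no ¬ty | _ = m , tm , λ { R (here refl) tR _ → contradiction tR ¬ty ; R (there p) → beats R p }
  ...   | yes _ | yes refl = m , tm , λ { R (here refl) _ R≢m → contradiction refl R≢m ; R (there p) → beats R p }
  ...   | yes ty | no y≢m with total m y tm ty (λ e → y≢m (sym e))
  ...     | inj₁ m⇒y = m , tm , λ { R (here refl) _ _ → m⇒y ; R (there p) → beats R p }
  ...     | inj₂ y⇒m = y , ty , beatenByY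
    where
    beatenByY : ∀ R → R ∈ y ∷ ys → T R → R ≢ y → y ⇒ R
    beatenByY R (here refl) _ R≢y = contradiction refl R≢y
    beatenByY R (there p) tR R≢y with R ≟ m
    ... | yes refl = y⇒m
    ... | no R≢m = transitive y m R ty tm tR y≢m (λ e → R≢m (sym e)) (λ e → R≢y (sym e)) y⇒m (beats R p tR R≢m)

  source : ∀ m₀ → T m₀ → ∃[ m ] (T m × (∀ R → T R → R ≢ m → m ⇒ R))
  source m₀ t₀ with sourceOf (allFin h) m₀ t₀
  ... | m , tm , beats = m , tm , λ R → beats R (∈-allFin R)

module Setting
  (G : Graph) (h : ℕ) (h≥4 : 4 ≤ h) (connected : Connected G) (Γ≤3 : GrundyAtMost3 G)
  (c : Coloring G h) (proper : Proper G c)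
  (complete : ∀ (i j : Fin h) → i ≢ j → ∃[ u ] ∃[ v ] (c u ≡ i × c v ≡ j × Adj G u v))
  (sizes : ∀ i → classSize G c i ≡ 1 ⊎ classSize G c i ≡ 2)
  (ia ib : Fin h) (ia≢ib : ia ≢ ib) (size-ia : classSize G c ia ≡ 1) (size-ib : classSize G c ib ≡ 1)
  (onlySingletons : ∀ i → classSize G c i ≡ 1 → i ≡ ia ⊎ i ≡ ib)
  where

  open ColourClasses G c

  V : Set
  V = Vertex G

  Pair : Fin h → Set
  Pair i = classSize G c i ≡ 2

  M : V → Set
  M v = InM G c v

  Isolated : V → Set
  Isolated v = IsolatedInM G c v

  TypeI : Fin h → Set
  TypeI i = Pair i × ∃[ v ] (c v ≡ i × Isolated v)

  TypeII : Fin h → Set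
  TypeII i = Pair i × ¬ TypeI i

  Sees : V → Fin h → Set
  Sees v j = ∃[ w ] (c w ≡ j × Adj G v w)

  impossible : PartialGrundy4 G → ⊥
  impossible = noPartialGrundy4 G Γ≤3

  Pair? : ∀ i → Dec (Pair i)
  Pair? i = classSize G c i ℕ.≟ 2

  M? : ∀ v → Dec (M v)
  M? v = Pair? (c v)

  Isolated? : ∀ v → Dec (Isolated v)
  Isolated? v = M? v ×-dec all? (λ u → M? u →-dec ¬? (dec G v u))

  TypeI? : ∀ i → Dec (TypeI i)
  TypeI? i = Pair? i ×-dec any? (λ v → (c v ≟ i) ×-dec Isolated? v)

  TypeII? : ∀ i → Dec (TypeII i)
  TypeII? i = Pair? i ×-dec ¬? (TypeI? i)

  Sees? : ∀ v j → Dec (Sees v j)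
  Sees? v j = any? (λ w → (c w ≟ j) ×-dec dec G v w)

  pair≢singleton : ∀ {i j} → Pair i → classSize G c j ≡ 1 → i ≢ j
  pair≢singleton p s refl with () ← trans (sym s) p

  pair-colour : ∀ i → i ≢ ia → i ≢ ib → Pair i
  pair-colour i i≢ia i≢ib with sizes i
  ... | inj₂ p = p
  ... | inj₁ s with onlySingletons i s
  ...   | inj₁ e = contradiction e i≢ia
  ...   | inj₂ e = contradiction e i≢ib

  same-colour-nonadjacent : ∀ {u v} → c u ≡ c v → ¬ Adj G u v
  same-colour-nonadjacent e a = proper a e

  inM : ∀ {u i} → c u ≡ i → Pair i → M u
  inM refl p = p

  isolated-nonadjacent : ∀ {y w} → Isolated y → M w → ¬ Adj G y w
  isolated-nonadjacent (_ , noNeighbour) w∈M = noNeighbour _ w∈M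

  isolated-nonadjacent′ : ∀ {y w} → Isolated y → M w → ¬ Adj G w y
  isolated-nonadjacent′ iy w∈M a = isolated-nonadjacent iy w∈M (adj-sym G a)

  M-neighbour : ∀ v → M v → ¬ Isolated v → ∃[ z ] (M z × Adj G v z)
  M-neighbour v v∈M ¬iso with all? (λ u → M? u →-dec ¬? (dec G v u))
  ... | yes none = contradiction (v∈M , none) ¬iso
  ... | no ¬none with ¬∀⟶∃¬ (n G) _ (λ u → M? u →-dec ¬? (dec G v u)) ¬none
  ...   | z , nz with M? z | dec G v z
  ...     | yes z∈M | yes a = z , z∈M , a
  ...     | yes _   | no ¬a = contradiction (λ _ → ¬a) nz
  ...     | no z∉M  | _     = contradiction (λ z∈M → contradiction z∈M z∉M) nz

  typeII-M-neighbour : ∀ {P v} → TypeII P → c v ≡ P → ∃[ z ] (M z × Adj G v z)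
  typeII-M-neighbour (pP , ¬I) e = M-neighbour _ (inM e pP) (λ iso → ¬I (pP , _ , e , iso))

  opaque
    a : V
    a = proj₁ (singletonClass ia size-ia)

    b : V
    b = proj₁ (singletonClass ib size-ib)

    colour-a : c a ≡ ia
    colour-a = proj₁ (proj₂ (singletonClass ia size-ia))

    colour-b : c b ≡ ib
    colour-b = proj₁ (proj₂ (singletonClass ib size-ib))

    only-a : ∀ w → c w ≡ ia → w ≡ a
    only-a = proj₂ (proj₂ (singletonClass ia size-ia))

    only-b : ∀ w → c w ≡ ib → w ≡ b
    only-b = proj₂ (proj₂ (singletonClass ib size-ib))

  a∉M : ¬ M a
  a∉M a∈M = pair≢singleton a∈M size-ia colour-a

  b∉M : ¬ M b
  b∉M b∈M = pair≢singleton b∈M size-ib colour-b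

  outsideM : ∀ q → ¬ M q → q ≡ a ⊎ q ≡ b
  outsideM q q∉M with sizes (c q)
  ... | inj₂ p = contradiction p q∉M
  ... | inj₁ s with onlySingletons (c q) s
  ...   | inj₁ e = inj₁ (only-a q e)
  ...   | inj₂ e = inj₂ (only-b q e)

  singleton-sees : ∀ s i → c s ≡ i → (∀ w → c w ≡ i → w ≡ s) → ∀ j → j ≢ i → Sees s j
  singleton-sees s i cs only j j≢i with complete i j (λ e → j≢i (sym e))
  ... | x , w , cx , cw , xw with only x cx
  ...   | refl = w , cw , xw

  a-sees : ∀ j → Pair j → Sees a j
  a-sees j pj = singleton-sees a ia colour-a only-a j (pair≢singleton pj size-ia)

  b-sees : ∀ j → Pair j → Sees b j
  b-sees j pj = singleton-sees b ib colour-b only-b j (pair≢singleton pj size-ib)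

  a~b : Adj G a b
  a~b with complete ia ib ia≢ib
  ... | x , y , cx , cy , xy with only-a x cx | only-b y cy
  ...   | refl | refl = xy

  record TypeIPair (i : Fin h) : Set where
    constructor typeIPair
    field
      x y      : V
      x≢y      : x ≢ y
      colour-x : c x ≡ i
      colour-y : c y ≡ i
      y-isolated : Isolated y
      members  : ∀ w → c w ≡ i → w ≡ x ⊎ w ≡ y

  typeIPair-of : ∀ {i} → TypeI i → TypeIPair i
  typeIPair-of {i} (pI , y , cy , iy) with pairClass i pI
  ... | p , q , p≢q , cp , cq , members with members y cy
  ...   | inj₁ refl = typeIPair q y (λ e → p≢q (sym e)) cq cy iy (λ w cw → swap (members w cw))
  ...   | inj₂ refl = typeIPair p y p≢q cp cy iy members

  -- completeness between two type-I pairs can only be realised by their x's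
  x-adjacent : ∀ {i j} → Pair i → Pair j → i ≢ j → (A : TypeIPair i) (B : TypeIPair j) →
    Adj G (TypeIPair.x A) (TypeIPair.x B)
  x-adjacent {i} {j} pi pj i≢j A B with complete i j i≢j
  ... | u , w , cu , cw , uw with TypeIPair.members A u cu | TypeIPair.members B w cw
  ...   | inj₁ refl | inj₁ refl = uw
  ...   | inj₁ refl | inj₂ refl = ⊥-elim (isolated-nonadjacent′ (TypeIPair.y-isolated B) (inM cu pi) uw)
  ...   | inj₂ refl | _         = ⊥-elim (isolated-nonadjacent (TypeIPair.y-isolated A) (inM cw pj) uw)

  x-sees : ∀ {i} j → Pair j → i ≢ j → (A : TypeIPair i) → Sees (TypeIPair.x A) j
  x-sees {i} j pj i≢j A with complete i j i≢j
  ... | u , w , cu , cw , uw with TypeIPair.members A u cu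
  ...   | inj₁ refl = w , cw , uw
  ...   | inj₂ refl = ⊥-elim (isolated-nonadjacent (TypeIPair.y-isolated A) (inM cw pj) uw)

  y-adjacent : ∀ {i} z (A : TypeIPair i) → Sees z i → ¬ Adj G (TypeIPair.x A) z → Adj G (TypeIPair.y A) z
  y-adjacent z A (w , cw , zw) ¬xz with TypeIPair.members A w cw
  ... | inj₁ refl = contradiction (adj-sym G zw) ¬xz
  ... | inj₂ refl = adj-sym G zw

  -- Forbidden configurations among M.  Each is turned into a partial Grundy
  -- 4-colouring (levels listed as K₁ | K₂ | K₃ | K₄).

  -- a triangle x₁x₂x₃ all of whose vertices see a further pair class R:
  -- R | x₁ | x₂ | x₃
  noTriangleSeeing : ∀ R → ∀ x₁ x₂ x₃ → c x₁ ≢ R → c x₂ ≢ R → c x₃ ≢ R →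
    Adj G x₁ x₂ → Adj G x₁ x₃ → Adj G x₂ x₃ → Sees x₁ R → Sees x₂ R → Sees x₃ R → ⊥
  noTriangleSeeing R x₁ x₂ x₃ c₁ c₂ c₃ a₁₂ a₁₃ a₂₃ (w₁ , e₁ , b₁) (w₂ , e₂ , b₂) (w₃ , e₃ , b₃) = impossible (record
    { K₁ = λ x → c x ≡ R ; K₂ = _≡ x₁ ; K₃ = _≡ x₂ ; K₄ = _≡ x₃
    ; K₁? = λ x → c x ≟ R ; K₂? = _≟ x₁ ; K₃? = _≟ x₂ ; K₄? = _≟ x₃
    ; indep₁ = λ e e′ → same-colour-nonadjacent (trans e (sym e′))
    ; indep₂ = λ { refl refl → irrefl G } ; indep₃ = λ { refl refl → irrefl G } ; indep₄ = λ { refl refl → irrefl G }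
    ; disj₁₂ = λ { e refl → c₁ e } ; disj₁₃ = λ { e refl → c₂ e } ; disj₁₄ = λ { e refl → c₃ e }
    ; disj₂₃ = λ { refl refl → irrefl G a₁₂ } ; disj₂₄ = λ { refl refl → irrefl G a₁₃ }
    ; disj₃₄ = λ { refl refl → irrefl G a₂₃ }
    ; dom₂₁ = λ { refl → w₁ , e₁ , b₁ }
    ; dom₃₁ = λ { refl → w₂ , e₂ , b₂ } ; dom₃₂ = λ { refl → x₁ , refl , adj-sym G a₁₂ }
    ; dom₄₁ = λ { refl → w₃ , e₃ , b₃ } ; dom₄₂ = λ { refl → x₁ , refl , adj-sym G a₁₃ }
    ; dom₄₃ = λ { refl → x₂ , refl , adj-sym G a₂₃ }
    ; top = x₃ , refl })

  -- a triangle xᵢxⱼxₖ of M, yᵢ isolated in G[M] and in the class of xᵢ, and a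
  -- vertex z ∉ M adjacent to yᵢ, xⱼ, xₖ:  {yᵢ, xᵢ} | xⱼ | z | xₖ
  noTriangleWithIsolatedTwin : ∀ z xᵢ yᵢ xⱼ xₖ → ¬ M z → M xᵢ → M xⱼ → M xₖ → Isolated yᵢ → c yᵢ ≡ c xᵢ →
    Adj G yᵢ z → Adj G xⱼ z → Adj G xₖ z → Adj G xᵢ xⱼ → Adj G xᵢ xₖ → Adj G xⱼ xₖ → ⊥
  noTriangleWithIsolatedTwin z xᵢ yᵢ xⱼ xₖ z∉M iᵢ iⱼ iₖ iy same yz jz kz aᵢⱼ aᵢₖ aⱼₖ = impossible (record
    { K₁ = λ x → x ≡ yᵢ ⊎ x ≡ xᵢ ; K₂ = _≡ xⱼ ; K₃ = _≡ z ; K₄ = _≡ xₖ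
    ; K₁? = λ x → (x ≟ yᵢ) ⊎-dec (x ≟ xᵢ) ; K₂? = _≟ xⱼ ; K₃? = _≟ z ; K₄? = _≟ xₖ
    ; indep₁ = λ { (inj₁ refl) (inj₁ refl) → irrefl G ; (inj₁ refl) (inj₂ refl) → same-colour-nonadjacent same
                 ; (inj₂ refl) (inj₁ refl) → same-colour-nonadjacent (sym same) ; (inj₂ refl) (inj₂ refl) → irrefl G }
    ; indep₂ = λ { refl refl → irrefl G } ; indep₃ = λ { refl refl → irrefl G } ; indep₄ = λ { refl refl → irrefl G }
    ; disj₁₂ = λ { (inj₁ refl) refl → isolated-nonadjacent iy iₖ aⱼₖ ; (inj₂ refl) refl → irrefl G aᵢⱼ }
    ; disj₁₃ = λ { (inj₁ refl) refl → z∉M (proj₁ iy) ; (inj₂ refl) refl → z∉M iᵢ }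
    ; disj₁₄ = λ { (inj₁ refl) refl → isolated-nonadjacent′ iy iⱼ aⱼₖ ; (inj₂ refl) refl → irrefl G aᵢₖ }
    ; disj₂₃ = λ { refl refl → z∉M iⱼ } ; disj₂₄ = λ { refl refl → irrefl G aⱼₖ } ; disj₃₄ = λ { refl refl → z∉M iₖ }
    ; dom₂₁ = λ { refl → xᵢ , inj₂ refl , adj-sym G aᵢⱼ }
    ; dom₃₁ = λ { refl → yᵢ , inj₁ refl , adj-sym G yz } ; dom₃₂ = λ { refl → xⱼ , refl , adj-sym G jz }
    ; dom₄₁ = λ { refl → xᵢ , inj₂ refl , adj-sym G aᵢₖ } ; dom₄₂ = λ { refl → xⱼ , refl , adj-sym G aⱼₖ }
    ; dom₄₃ = λ { refl → z , refl , kz }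
    ; top = xₖ , refl })

  -- adjacent s, t ∉ M; a triangle xₗxₘxₖ of M with xₗ ~ s, xₖ ≁ t; yₖ isolated
  -- in G[M], in the class of xₖ, adjacent to s and t:  {yₖ, xₘ} | {t, xₖ} | s | xₗ
  noTriangleUnderEdge : ∀ s t xₗ xₘ xₖ yₖ → ¬ M s → ¬ M t → Adj G s t → M xₗ → M xₘ → M xₖ →
    Isolated yₖ → c yₖ ≡ c xₖ → yₖ ≢ xₖ → Adj G yₖ s → Adj G yₖ t → ¬ Adj G xₖ t → Adj G xₗ s →
    Adj G xₗ xₘ → Adj G xₗ xₖ → Adj G xₘ xₖ → ⊥
  noTriangleUnderEdge s t xₗ xₘ xₖ yₖ s∉M t∉M st iₗ iₘ iₖ iy same yₖ≢xₖ ys yt ¬kt ls lm lk mk = impossible (record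
    { K₁ = λ x → x ≡ yₖ ⊎ x ≡ xₘ ; K₂ = λ x → x ≡ t ⊎ x ≡ xₖ ; K₃ = _≡ s ; K₄ = _≡ xₗ
    ; K₁? = λ x → (x ≟ yₖ) ⊎-dec (x ≟ xₘ) ; K₂? = λ x → (x ≟ t) ⊎-dec (x ≟ xₖ) ; K₃? = _≟ s ; K₄? = _≟ xₗ
    ; indep₁ = λ { (inj₁ refl) (inj₁ refl) → irrefl G ; (inj₁ refl) (inj₂ refl) → isolated-nonadjacent iy iₘ
                 ; (inj₂ refl) (inj₁ refl) → isolated-nonadjacent′ iy iₘ ; (inj₂ refl) (inj₂ refl) → irrefl G }
    ; indep₂ = λ { (inj₁ refl) (inj₁ refl) → irrefl G ; (inj₁ refl) (inj₂ refl) → λ a → ¬kt (adj-sym G a)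
                 ; (inj₂ refl) (inj₁ refl) → ¬kt ; (inj₂ refl) (inj₂ refl) → irrefl G }
    ; indep₃ = λ { refl refl → irrefl G } ; indep₄ = λ { refl refl → irrefl G }
    ; disj₁₂ = λ { (inj₁ refl) (inj₁ refl) → t∉M (proj₁ iy) ; (inj₁ refl) (inj₂ refl) → yₖ≢xₖ refl
                 ; (inj₂ refl) (inj₁ refl) → t∉M iₘ ; (inj₂ refl) (inj₂ refl) → irrefl G mk }
    ; disj₁₃ = λ { (inj₁ refl) refl → s∉M (proj₁ iy) ; (inj₂ refl) refl → s∉M iₘ }
    ; disj₁₄ = λ { (inj₁ refl) refl → isolated-nonadjacent iy iₘ lm ; (inj₂ refl) refl → irrefl G lm }
    ; disj₂₃ = λ { (inj₁ refl) refl → irrefl G st ; (inj₂ refl) refl → s∉M iₖ }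
    ; disj₂₄ = λ { (inj₁ refl) refl → t∉M iₗ ; (inj₂ refl) refl → irrefl G lk }
    ; disj₃₄ = λ { refl refl → s∉M iₗ }
    ; dom₂₁ = λ { (inj₁ refl) → yₖ , inj₁ refl , adj-sym G yt ; (inj₂ refl) → xₘ , inj₂ refl , adj-sym G mk }
    ; dom₃₁ = λ { refl → yₖ , inj₁ refl , adj-sym G ys } ; dom₃₂ = λ { refl → t , inj₁ refl , st }
    ; dom₄₁ = λ { refl → xₘ , inj₂ refl , lm } ; dom₄₂ = λ { refl → xₖ , inj₂ refl , lk }
    ; dom₄₃ = λ { refl → s , refl , ls }
    ; top = xₗ , refl })

  -- The arguments around the edge ab are symmetric in a and b: they are
  -- developed for an adjacent pair s, t ∉ M seeing every pair colour, and
  -- used for (s, t) = (a, b) and (b, a).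
  module Oriented (s t : V) (s∉M : ¬ M s) (t∉M : ¬ M t) (s~t : Adj G s t)
    (s-sees : ∀ j → Pair j → Sees s j) (t-sees : ∀ j → Pair j → Sees t j) where

    -- M-vertices u ~ s and v ~ t (equal or non-adjacent) outside a pair class S
    -- that they both see:  S | {u, v} | s | t
    noLadder : ∀ S → Pair S → ∀ u v → M u → M v → c u ≢ S → c v ≢ S →
      Adj G u s → Adj G v t → Sees u S → Sees v S → u ≡ v ⊎ ¬ Adj G u v → ⊥
    noLadder S pS u v u∈M v∈M cu cv us vt (x , cx , ux) (y , cy , vy) u=v∨u≁v = impossible (record
      { K₁ = λ w → c w ≡ S ; K₂ = λ w → w ≡ u ⊎ w ≡ v ; K₃ = _≡ s ; K₄ = _≡ t
      ; K₁? = λ w → c w ≟ S ; K₂? = λ w → (w ≟ u) ⊎-dec (w ≟ v) ; K₃? = _≟ s ; K₄? = _≟ t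
      ; indep₁ = λ e e′ → same-colour-nonadjacent (trans e (sym e′))
      ; indep₂ = λ { (inj₁ refl) (inj₁ refl) → irrefl G ; (inj₁ refl) (inj₂ refl) → u≁v
                   ; (inj₂ refl) (inj₁ refl) → λ a → u≁v (adj-sym G a) ; (inj₂ refl) (inj₂ refl) → irrefl G }
      ; indep₃ = λ { refl refl → irrefl G } ; indep₄ = λ { refl refl → irrefl G }
      ; disj₁₂ = λ { e (inj₁ refl) → cu e ; e (inj₂ refl) → cv e }
      ; disj₁₃ = λ { e refl → s∉M (subst Pair (sym e) pS) }
      ; disj₁₄ = λ { e refl → t∉M (subst Pair (sym e) pS) }
      ; disj₂₃ = λ { (inj₁ refl) refl → s∉M u∈M ; (inj₂ refl) refl → s∉M v∈M }
      ; disj₂₄ = λ { (inj₁ refl) refl → t∉M u∈M ; (inj₂ refl) refl → t∉M v∈M }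
      ; disj₃₄ = λ { refl refl → irrefl G s~t }
      ; dom₂₁ = λ { (inj₁ refl) → x , cx , ux ; (inj₂ refl) → y , cy , vy }
      ; dom₃₁ = λ { refl → s-sees S pS } ; dom₃₂ = λ { refl → u , inj₁ refl , adj-sym G us }
      ; dom₄₁ = λ { refl → t-sees S pS } ; dom₄₂ = λ { refl → v , inj₂ refl , adj-sym G vt }
      ; dom₄₃ = λ { refl → s , refl , adj-sym G s~t }
      ; top = t , refl })
      where
      nonadjacent : u ≡ v ⊎ ¬ Adj G u v → ¬ Adj G u v
      nonadjacent (inj₁ refl) = irrefl G
      nonadjacent (inj₂ n)    = n
      u≁v : ¬ Adj G u v
      u≁v = nonadjacent u=v∨u≁v

    noCommonNeighbour : ∀ u → M u → Adj G u s → Adj G u t → ¬ (∃[ z ] (M z × Adj G u z))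
    noCommonNeighbour u u∈M us ut (z , z∈M , uz) =
      noLadder (c z) z∈M u u u∈M u∈M (proper uz) (proper uz) us ut (z , refl , uz) (z , refl , uz) (inj₁ refl)

    typeII-split : ∀ P → TypeII P → ∀ u → c u ≡ P → Adj G u s →
      ∃[ u′ ] (c u′ ≡ P × Adj G u′ t × ¬ Adj G u′ s × ¬ Adj G u t × (∀ w → c w ≡ P → w ≡ u ⊎ w ≡ u′))
    typeII-split P tP u cu us with pairClass P (proj₁ tP)
    ... | p , q , _ , cp , cq , members = split (partner (members u cu))
      where
      u≁t : ¬ Adj G u t
      u≁t ut = noCommonNeighbour u (inM cu (proj₁ tP)) us ut (typeII-M-neighbour tP cu)
      partner : u ≡ p ⊎ u ≡ q → ∃[ u′ ] (c u′ ≡ P × (∀ w → c w ≡ P → w ≡ u ⊎ w ≡ u′))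
      partner (inj₁ refl) = q , cq , members
      partner (inj₂ refl) = p , cp , λ w cw → swap (members w cw)
      split : ∃[ u′ ] (c u′ ≡ P × (∀ w → c w ≡ P → w ≡ u ⊎ w ≡ u′)) →
        ∃[ u′ ] (c u′ ≡ P × Adj G u′ t × ¬ Adj G u′ s × ¬ Adj G u t × (∀ w → c w ≡ P → w ≡ u ⊎ w ≡ u′))
      split (u′ , cu′ , members′) with t-sees P (proj₁ tP)
      ... | w , cw , tw with members′ w cw
      ...   | inj₁ refl = ⊥-elim (u≁t (adj-sym G tw))
      ...   | inj₂ refl = w , cu′ , adj-sym G tw , w≁s , u≁t , members′
        where
        w≁s : ¬ Adj G w s
        w≁s ws = noCommonNeighbour w (inM cu′ (proj₁ tP)) ws (adj-sym G tw) (typeII-M-neighbour tP cu′)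

    -- M-vertices u ≁ u′ of one class, w ~ u, z ~ u′ with c z = T, where u, w ~ s,
    -- u′ ~ t and w does not see T:  T ∪ {w} | {u, u′} | t | s
    noDoubleLadder : ∀ T → Pair T → ∀ u u′ w z → M u → M u′ → M w → c z ≡ T → c u ≢ T → c u′ ≢ T →
      ¬ Sees w T → ¬ Adj G u u′ → c u′ ≢ c w →
      Adj G u w → Adj G u′ z → Adj G u s → Adj G w s → Adj G u′ t → ⊥
    noDoubleLadder T pT u u′ w z u∈M u′∈M w∈M cz cu cu′ ¬wT u≁u′ cu′≢cw uw u′z us ws u′t = impossible (record
      { K₁ = λ x → c x ≡ T ⊎ x ≡ w ; K₂ = λ x → x ≡ u ⊎ x ≡ u′ ; K₃ = _≡ t ; K₄ = _≡ s
      ; K₁? = λ x → (c x ≟ T) ⊎-dec (x ≟ w) ; K₂? = λ x → (x ≟ u) ⊎-dec (x ≟ u′) ; K₃? = _≟ t ; K₄? = _≟ s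
      ; indep₁ = λ { (inj₁ e) (inj₁ e′) → same-colour-nonadjacent (trans e (sym e′))
                   ; {x} (inj₁ e) (inj₂ refl) → λ a → ¬wT (x , e , adj-sym G a)
                   ; {_} {y} (inj₂ refl) (inj₁ e) → λ a → ¬wT (y , e , a)
                   ; (inj₂ refl) (inj₂ refl) → irrefl G }
      ; indep₂ = λ { (inj₁ refl) (inj₁ refl) → irrefl G ; (inj₁ refl) (inj₂ refl) → u≁u′
                   ; (inj₂ refl) (inj₁ refl) → λ a → u≁u′ (adj-sym G a) ; (inj₂ refl) (inj₂ refl) → irrefl G }
      ; indep₃ = λ { refl refl → irrefl G } ; indep₄ = λ { refl refl → irrefl G }
      ; disj₁₂ = λ { (inj₁ e) (inj₁ refl) → cu e ; (inj₁ e) (inj₂ refl) → cu′ e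
                   ; (inj₂ refl) (inj₁ refl) → irrefl G uw ; (inj₂ refl) (inj₂ refl) → cu′≢cw refl }
      ; disj₁₃ = λ { (inj₁ e) refl → t∉M (subst Pair (sym e) pT) ; (inj₂ refl) refl → t∉M w∈M }
      ; disj₁₄ = λ { (inj₁ e) refl → s∉M (subst Pair (sym e) pT) ; (inj₂ refl) refl → s∉M w∈M }
      ; disj₂₃ = λ { (inj₁ refl) refl → t∉M u∈M ; (inj₂ refl) refl → t∉M u′∈M }
      ; disj₂₄ = λ { (inj₁ refl) refl → s∉M u∈M ; (inj₂ refl) refl → s∉M u′∈M }
      ; disj₃₄ = λ { refl refl → irrefl G s~t }
      ; dom₂₁ = λ { (inj₁ refl) → w , inj₂ refl , uw ; (inj₂ refl) → z , inj₁ cz , u′z }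
      ; dom₃₁ = λ { refl → let (x , cx , tx) = t-sees T pT in x , inj₁ cx , tx }
      ; dom₃₂ = λ { refl → u′ , inj₂ refl , adj-sym G u′t }
      ; dom₄₁ = λ { refl → w , inj₂ refl , adj-sym G ws } ; dom₄₂ = λ { refl → u , inj₁ refl , adj-sym G us }
      ; dom₄₃ = λ { refl → t , refl , s~t }
      ; top = s , refl })

    typeII-edge-two-sided : ∀ P R → TypeII P → TypeII R → P ≢ R → ∀ u w → c u ≡ P → c w ≡ R →
      Adj G u w → Adj G u s → Adj G w s → ⊥
    typeII-edge-two-sided P R tP tR P≢R u w cu cw uw us ws with typeII-split P tP u cu us
    ... | u′ , cu′ , u′t , _ , _ , _ = closeOff (typeII-M-neighbour tP cu′)
      where
      u∈M : M u
      u∈M = inM cu (proj₁ tP)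
      u′∈M : M u′
      u′∈M = inM cu′ (proj₁ tP)
      w∈M : M w
      w∈M = inM cw (proj₁ tR)
      u≁u′ : ¬ Adj G u u′
      u≁u′ = same-colour-nonadjacent (trans cu (sym cu′))
      -- u′ cannot see R: together with u ~ w this is a ladder over R
      u′-blind-to-R : ¬ Sees u′ R
      u′-blind-to-R sees = noLadder R (proj₁ tR) u u′ u∈M u′∈M (λ e → P≢R (trans (sym cu) e))
        (λ e → P≢R (trans (sym cu′) e)) us u′t (w , cw , uw) sees (inj₂ u≁u′)
      -- so the M-neighbour z of u′ has a third colour; whether w sees it or not, G is 4-Grundy
      closeOff : ∃[ z ] (M z × Adj G u′ z) → ⊥
      closeOff (z , z∈M , u′z) with c z ≟ R | Sees? w (c z)
      ... | yes czR | _         = u′-blind-to-R (z , czR , u′z)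
      ... | no czR  | yes wSees =
        noLadder (c z) z∈M w u′ w∈M u′∈M (λ e → czR (trans (sym e) cw)) (proper u′z) ws u′t wSees
          (z , refl , u′z) (inj₂ (λ wu′ → u′-blind-to-R (w , cw , adj-sym G wu′)))
      ... | no _    | no ¬wSees =
        noDoubleLadder (c z) z∈M u u′ w z u∈M u′∈M w∈M refl (λ e → proper u′z (trans cu′ (trans (sym cu) e)))
          (proper u′z) ¬wSees u≁u′ (λ e → P≢R (trans (sym cu′) (trans e cw))) uw u′z us ws u′t

    typeI-x-avoids : ∀ {i₁ i₂ i₃} → Pair i₁ → Pair i₂ → Pair i₃ → i₁ ≢ i₂ → i₁ ≢ i₃ → i₂ ≢ i₃ →
      (A : TypeIPair i₁) (B : TypeIPair i₂) (C : TypeIPair i₃) → ¬ Adj G (TypeIPair.x A) s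
    typeI-x-avoids {i₁} {i₂} {i₃} p₁ p₂ p₃ d₁₂ d₁₃ d₂₃ A B C x₁s = cases (dec G x₂ s) (dec G x₃ s)
      where
      open TypeIPair A renaming (x to x₁; y to y₁; x≢y to x≢y₁; colour-x to cx₁; colour-y to cy₁; y-isolated to iy₁)
      open TypeIPair B renaming (x to x₂; y to y₂; x≢y to x≢y₂; colour-x to cx₂; colour-y to cy₂; y-isolated to iy₂)
      open TypeIPair C renaming (x to x₃; y to y₃; x≢y to x≢y₃; colour-x to cx₃; colour-y to cy₃; y-isolated to iy₃)
      x₁∈M : M x₁
      x₁∈M = inM cx₁ p₁
      x₂∈M : M x₂
      x₂∈M = inM cx₂ p₂
      x₃∈M : M x₃
      x₃∈M = inM cx₃ p₃
      a₁₂ : Adj G x₁ x₂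
      a₁₂ = x-adjacent p₁ p₂ d₁₂ A B
      a₁₃ : Adj G x₁ x₃
      a₁₃ = x-adjacent p₁ p₃ d₁₃ A C
      a₂₃ : Adj G x₂ x₃
      a₂₃ = x-adjacent p₂ p₃ d₂₃ B C
      x₁≁t : ¬ Adj G x₁ t
      x₁≁t x₁t = noCommonNeighbour x₁ x₁∈M x₁s x₁t (x₂ , x₂∈M , a₁₂)
      -- where xⱼ ≁ s (or ≁ t), the singleton reaches colour iⱼ through yⱼ
      cases : Dec (Adj G x₂ s) → Dec (Adj G x₃ s) → ⊥
      cases (yes x₂s) (yes x₃s) = noK4 G Γ≤3 a₁₂ a₁₃ x₁s a₂₃ x₂s x₃s
      cases (yes x₂s) (no x₃≁s) =
        noTriangleWithIsolatedTwin s x₃ y₃ x₂ x₁ s∉M x₃∈M x₂∈M x₁∈M iy₃ (trans cy₃ (sym cx₃))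
          (y-adjacent s C (s-sees i₃ p₃) x₃≁s) x₂s x₁s (adj-sym G a₂₃) (adj-sym G a₁₃) (adj-sym G a₁₂)
      cases (no x₂≁s) (yes x₃s) =
        noTriangleWithIsolatedTwin s x₂ y₂ x₃ x₁ s∉M x₂∈M x₃∈M x₁∈M iy₂ (trans cy₂ (sym cx₂))
          (y-adjacent s B (s-sees i₂ p₂) x₂≁s) x₃s x₁s a₂₃ (adj-sym G a₁₂) (adj-sym G a₁₃)
      cases (no x₂≁s) (no x₃≁s) with dec G x₂ t | dec G x₃ t
      ... | yes x₂t | yes x₃t =
        noTriangleWithIsolatedTwin t x₁ y₁ x₂ x₃ t∉M x₁∈M x₂∈M x₃∈M iy₁ (trans cy₁ (sym cx₁))
          (y-adjacent t A (t-sees i₁ p₁) x₁≁t) x₂t x₃t a₁₂ a₁₃ a₂₃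
      ... | no x₂≁t | _ =
        noTriangleUnderEdge s t x₁ x₃ x₂ y₂ s∉M t∉M s~t x₁∈M x₃∈M x₂∈M iy₂ (trans cy₂ (sym cx₂)) (λ e → x≢y₂ (sym e))
          (y-adjacent s B (s-sees i₂ p₂) x₂≁s) (y-adjacent t B (t-sees i₂ p₂) x₂≁t) x₂≁t x₁s a₁₃ a₁₂ (adj-sym G a₂₃)
      ... | yes _ | no x₃≁t =
        noTriangleUnderEdge s t x₁ x₂ x₃ y₃ s∉M t∉M s~t x₁∈M x₂∈M x₃∈M iy₃ (trans cy₃ (sym cx₃)) (λ e → x≢y₃ (sym e))
          (y-adjacent s C (s-sees i₃ p₃) x₃≁s) (y-adjacent t C (t-sees i₃ p₃) x₃≁t) x₃≁t x₁s a₁₂ a₁₃ a₂₃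

  module AB = Oriented a b a∉M b∉M a~b a-sees b-sees
  module BA = Oriented b a b∉M a∉M (adj-sym G a~b) b-sees a-sees

  typeII-side : ∀ {P u} → TypeII P → c u ≡ P → (Adj G u a × ¬ Adj G u b) ⊎ (Adj G u b × ¬ Adj G u a)
  typeII-side {P} {u} tP cu with a-sees P (proj₁ tP)
  ... | w , cw , aw with AB.typeII-split P tP w cw (adj-sym G aw)
  ...   | u′ , _ , u′b , u′≁a , w≁b , members with members u cu
  ...     | inj₁ refl = inj₁ (adj-sym G aw , w≁b)
  ...     | inj₂ refl = inj₂ (u′b , u′≁a)

  typeII-edge : ∀ {P R u w} → TypeII P → TypeII R → P ≢ R → c u ≡ P → c w ≡ R → Adj G u w →
    (Adj G u a × Adj G w b) ⊎ (Adj G u b × Adj G w a)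
  typeII-edge {P} {R} {u} {w} tP tR P≢R cu cw uw = combine (typeII-side tP cu) (typeII-side tR cw)
    where
    combine : (Adj G u a × ¬ Adj G u b) ⊎ (Adj G u b × ¬ Adj G u a) →
              (Adj G w a × ¬ Adj G w b) ⊎ (Adj G w b × ¬ Adj G w a) →
              (Adj G u a × Adj G w b) ⊎ (Adj G u b × Adj G w a)
    combine (inj₁ (ua , _)) (inj₁ (wa , _)) = ⊥-elim (AB.typeII-edge-two-sided P R tP tR P≢R u w cu cw uw ua wa)
    combine (inj₂ (ub , _)) (inj₂ (wb , _)) = ⊥-elim (BA.typeII-edge-two-sided P R tP tR P≢R u w cu cw uw ub wb)
    combine (inj₁ (ua , _)) (inj₂ (wb , _)) = inj₁ (ua , wb)
    combine (inj₂ (ub , _)) (inj₁ (wa , _)) = inj₂ (ub , wa)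

  _⇒_ : Fin h → Fin h → Set
  P ⇒ R = ∃[ u ] ∃[ v ] (c u ≡ P × c v ≡ R × Adj G u v × Adj G u a × Adj G v b)

  ⇒-total : ∀ P R → TypeII P → TypeII R → P ≢ R → P ⇒ R ⊎ R ⇒ P
  ⇒-total P R tP tR P≢R = orient (complete P R P≢R)
    where
    orient : ∃[ u ] ∃[ w ] (c u ≡ P × c w ≡ R × Adj G u w) → P ⇒ R ⊎ R ⇒ P
    orient (u , w , cu , cw , uw) =
      Sum.map (λ (ua , wb) → u , w , cu , cw , uw , ua , wb)
              (λ (ub , wa) → w , u , cw , cu , adj-sym G uw , wa , ub)
              (typeII-edge tP tR P≢R cu cw uw)

  ⇒-asym : ∀ P R → TypeII P → TypeII R → P ≢ R → P ⇒ R → ¬ R ⇒ P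
  ⇒-asym P R tP tR P≢R (u₁ , v₁ , cu₁ , cv₁ , u₁v₁ , u₁a , v₁b) (u₂ , v₂ , cu₂ , cv₂ , u₂v₂ , u₂a , v₂b) =
    AB.noLadder R (proj₁ tR) u₁ v₂ (inM cu₁ (proj₁ tP)) (inM cv₂ (proj₁ tP))
      (λ e → P≢R (trans (sym cu₁) e)) (λ e → P≢R (trans (sym cv₂) e)) u₁a v₂b
      (v₁ , cv₁ , u₁v₁) (u₂ , cu₂ , adj-sym G u₂v₂) (inj₂ (same-colour-nonadjacent (trans cu₁ (sym cv₂))))

  ⇒-trans : ∀ P R S → TypeII P → TypeII R → TypeII S → P ≢ R → R ≢ S → P ≢ S → P ⇒ R → R ⇒ S → P ⇒ S
  ⇒-trans P R S tP tR tS P≢R R≢S P≢S P⇒R (u , v , cu , cv , uv , ua , vb) =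
    Sum.[ id , (λ S⇒P → ⊥-elim (no-S⇒P S⇒P)) ] (⇒-total P S tP tS P≢S)
    where
    -- an edge u′v′ from S to P would close a ladder over S with u and v′
    no-S⇒P : ¬ S ⇒ P
    no-S⇒P (u′ , v′ , cu′ , cv′ , u′v′ , u′a , v′b) =
      AB.noLadder S (proj₁ tS) u v′ (inM cu (proj₁ tR)) (inM cv′ (proj₁ tP))
        (λ e → R≢S (trans (sym cu) e)) (λ e → P≢S (trans (sym cv′) e)) ua v′b
        (v , cv , uv) (u′ , cu′ , adj-sym G u′v′)
        (inj₂ (λ uv′ → ⇒-asym P R tP tR P≢R P⇒R (u , v′ , cu , cv′ , uv′ , ua , v′b)))

  module Source = Tournament TypeII TypeII? _⇒_ ⇒-total ⇒-trans
  module Sink = Tournament TypeII TypeII? (λ P R → R ⇒ P)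
    (λ P R tP tR P≢R → swap (⇒-total P R tP tR P≢R))
    (λ P R S tP tR tS P≢R R≢S P≢S R⇒P S⇒R →
      ⇒-trans S R P tS tR tP (λ e → R≢S (sym e)) (λ e → P≢R (sym e)) (λ e → P≢S (sym e)) S⇒R R⇒P)

  typeI-or-typeII : ∀ {R} → Pair R → ¬ TypeII R → TypeI R
  typeI-or-typeII {R} pR ¬II = decidable-stable (TypeI? R) (λ ¬I → ¬II (pR , ¬I))

  source-neighbour-typeI : ∀ m → TypeII m → (∀ R → TypeII R → R ≢ m → m ⇒ R) →
    ∀ v z → c v ≡ m → Adj G v b → M z → Adj G v z → TypeI (c z)
  source-neighbour-typeI m tm source v z cv vb z∈M vz = typeI-or-typeII z∈M notII
    where
    notII : ¬ TypeII (c z)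
    notII tR = Sum.[ (λ (va , _) → AB.noCommonNeighbour v (inM cv (proj₁ tm)) va vb (z , z∈M , vz))
                   , (λ (_ , za) → ⇒-asym m (c z) tm tR m≢cz (source (c z) tR (λ e → m≢cz (sym e)))
                                     (z , v , refl , cv , adj-sym G vz , za , vb)) ]
                   (typeII-edge tm tR m≢cz cv refl vz)
      where
      m≢cz : m ≢ c z
      m≢cz e = proper vz (trans cv e)

  sink-neighbour-typeI : ∀ m → TypeII m → (∀ R → TypeII R → R ≢ m → R ⇒ m) →
    ∀ u z → c u ≡ m → Adj G u a → M z → Adj G u z → TypeI (c z)
  sink-neighbour-typeI m tm sink u z cu ua z∈M uz = typeI-or-typeII z∈M notII
    where
    notII : ¬ TypeII (c z)
    notII tR = Sum.[ (λ (_ , zb) → ⇒-asym m (c z) tm tR m≢cz (u , z , cu , refl , uz , ua , zb)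
                                     (sink (c z) tR (λ e → m≢cz (sym e))))
                   , (λ (ub , _) → AB.noCommonNeighbour u (inM cu (proj₁ tm)) ua ub (z , z∈M , uz)) ]
                   (typeII-edge tm tR m≢cz cu refl uz)
      where
      m≢cz : m ≢ c z
      m≢cz e = proper uz (trans cu e)

  twoPairs : ∃[ P ] ∃[ R ] (Pair P × Pair R × P ≢ R)
  twoPairs with missing (ia ∷ ib ∷ []) (≤-trans (s≤s (s≤s (s≤s z≤n))) h≥4)
  ... | P , P∉ with missing (ia ∷ ib ∷ P ∷ []) h≥4
  ...   | R , R∉ = P , R , pair-colour P (λ e → P∉ (here e)) (λ e → P∉ (there (here e)))
                         , pair-colour R (λ e → R∉ (here e)) (λ e → R∉ (there (here e)))
                         , (λ e → R∉ (there (there (here (sym e)))))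

  AtMostOneTypeI : Set
  AtMostOneTypeI = ∀ i j → TypeI i → TypeI j → i ≡ j

  typeII-exists : AtMostOneTypeI → ∃[ m ] TypeII m
  typeII-exists atMostOne with twoPairs
  ... | P , R , pP , pR , P≢R with TypeI? P | TypeI? R
  ...   | no ¬I | _     = P , pP , ¬I
  ...   | yes _ | no ¬I = R , pR , ¬I
  ...   | yes I | yes J = contradiction (atMostOne P R I J) P≢R

  -- Let m be a ⇒-source and m′ a ⇒-sink among the type-II pairs, u ∈ m′
  -- adjacent to a and v ∈ m adjacent to b.  The M-neighbours of u and v lie in
  -- type-I pairs; if there is only one, S, then u, v and S form a ladder.
  extremes-ladder : AtMostOneTypeI → ∀ {m m′} → TypeII m → TypeII m′ →
    (∀ R → TypeII R → R ≢ m → m ⇒ R) → (∀ R → TypeII R → R ≢ m′ → R ⇒ m′) →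
    ∀ {u v} → c u ≡ m′ → c v ≡ m → Adj G u a → Adj G v b →
    ∃[ z′ ] (M z′ × Adj G u z′) → ∃[ z ] (M z × Adj G v z) → ⊥
  extremes-ladder atMostOne {m} {m′} tm tm′ source sink {u} {v} cu cv ua vb (z′ , z′∈M , uz′) (z , z∈M , vz) =
    AB.noLadder (c z) z∈M u v (inM cu (proj₁ tm′)) (inM cv (proj₁ tm)) cu≢S cv≢S ua vb
      (z′ , sym sameS , uz′) (z , refl , vz) (inj₂ (u≁v (m′ ≟ m)))
    where
    S-typeI : TypeI (c z)
    S-typeI = source-neighbour-typeI m tm source v z cv vb z∈M vz
    sameS : c z ≡ c z′
    sameS = atMostOne (c z) (c z′) S-typeI (sink-neighbour-typeI m′ tm′ sink u z′ cu ua z′∈M uz′)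
    cu≢S : c u ≢ c z
    cu≢S e = proj₂ tm′ (subst TypeI (sym (trans (sym cu) e)) S-typeI)
    cv≢S : c v ≢ c z
    cv≢S e = proj₂ tm (subst TypeI (sym (trans (sym cv) e)) S-typeI)
    -- an edge uv would be an arrow m′ ⇒ m against the source m
    u≁v : Dec (m′ ≡ m) → ¬ Adj G u v
    u≁v (yes e)    = same-colour-nonadjacent (trans cu (trans e (sym cv)))
    u≁v (no m′≢m) uv = ⇒-asym m m′ tm tm′ (λ e → m′≢m (sym e)) (source m′ tm′ m′≢m) (u , v , cu , cv , uv , ua , vb)

  atLeastTwo : ¬ AtMostOneTypeI
  atLeastTwo atMostOne =
    let (m₀ , t₀)         = typeII-exists atMostOne
        (m , tm , source) = Source.source m₀ t₀
        (m′ , tm′ , sink) = Sink.source m₀ t₀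
        (v , cv , bv)     = b-sees m (proj₁ tm)
        (u , cu , au)     = a-sees m′ (proj₁ tm′)
    in extremes-ladder atMostOne tm tm′ source sink cu cv (adj-sym G au) (adj-sym G bv)
         (typeII-M-neighbour tm′ cu) (typeII-M-neighbour tm cv)

  typeIPair-other : ∀ {i q} (X : TypeIPair i) → c q ≡ i → q ≢ TypeIPair.x X → Isolated q
  typeIPair-other X cq q≢x with TypeIPair.members X _ cq
  ... | inj₁ q≡x = contradiction q≡x q≢x
  ... | inj₂ refl = TypeIPair.y-isolated X

  typeI-x-avoids-singletons : ∀ {i₁ i₂ i₃} → Pair i₁ → Pair i₂ → Pair i₃ → i₁ ≢ i₂ → i₁ ≢ i₃ → i₂ ≢ i₃ →
    (A : TypeIPair i₁) (B : TypeIPair i₂) (C : TypeIPair i₃) → ∀ q → q ≡ a ⊎ q ≡ b → ¬ Adj G (TypeIPair.x A) q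
  typeI-x-avoids-singletons p₁ p₂ p₃ d₁₂ d₁₃ d₂₃ A B C _ (inj₁ refl) = AB.typeI-x-avoids p₁ p₂ p₃ d₁₂ d₁₃ d₂₃ A B C
  typeI-x-avoids-singletons p₁ p₂ p₃ d₁₂ d₁₃ d₂₃ A B C _ (inj₂ refl) = BA.typeI-x-avoids p₁ p₂ p₃ d₁₂ d₁₃ d₂₃ A B C

  -- The x's of three type-I pairs form a triangle.  A fourth pair
  -- class would be seen by all of it; otherwise the walk from x₁ to a leaves the
  -- triangle along an edge xq, where q ∈ M would be an isolated y and q ∉ M is a or b.
  atMostTwo : ∀ {i₁ i₂ i₃} → i₁ ≢ i₂ → i₁ ≢ i₃ → i₂ ≢ i₃ → TypeI i₁ → TypeI i₂ → TypeI i₃ → ⊥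
  atMostTwo {i₁} {i₂} {i₃} d₁₂ d₁₃ d₂₃ I₁ I₂ I₃ = cases (any? Fourth?)
    where
    p₁ : Pair i₁
    p₁ = proj₁ I₁
    p₂ : Pair i₂
    p₂ = proj₁ I₂
    p₃ : Pair i₃
    p₃ = proj₁ I₃
    A : TypeIPair i₁
    A = typeIPair-of I₁
    B : TypeIPair i₂
    B = typeIPair-of I₂
    C : TypeIPair i₃
    C = typeIPair-of I₃
    open TypeIPair A using () renaming (x to x₁; colour-x to cx₁)
    open TypeIPair B using () renaming (x to x₂; colour-x to cx₂)
    open TypeIPair C using () renaming (x to x₃; colour-x to cx₃)

    Fourth : Fin h → Set
    Fourth R = Pair R × R ≢ i₁ × R ≢ i₂ × R ≢ i₃

    Fourth? : ∀ R → Dec (Fourth R)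
    Fourth? R = Pair? R ×-dec (¬? (R ≟ i₁) ×-dec (¬? (R ≟ i₂) ×-dec ¬? (R ≟ i₃)))

    Triangle : V → Set
    Triangle v = v ≡ x₁ ⊎ v ≡ x₂ ⊎ v ≡ x₃

    Triangle? : ∀ v → Dec (Triangle v)
    Triangle? v = (v ≟ x₁) ⊎-dec ((v ≟ x₂) ⊎-dec (v ≟ x₃))

    triangle⊆M : ∀ {v} → Triangle v → M v
    triangle⊆M (inj₁ refl)        = inM cx₁ p₁
    triangle⊆M (inj₂ (inj₁ refl)) = inM cx₂ p₂
    triangle⊆M (inj₂ (inj₂ refl)) = inM cx₃ p₃

    outside-isolated : ¬ (∃[ R ] Fourth R) → ∀ q → M q → ¬ Triangle q → Isolated q
    outside-isolated ¬fourth q q∈M ¬tq with c q ≟ i₁ | c q ≟ i₂ | c q ≟ i₃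
    ... | yes e | _     | _     = typeIPair-other A e (λ q≡x → ¬tq (inj₁ q≡x))
    ... | no _  | yes e | _     = typeIPair-other B e (λ q≡x → ¬tq (inj₂ (inj₁ q≡x)))
    ... | no _  | no _  | yes e = typeIPair-other C e (λ q≡x → ¬tq (inj₂ (inj₂ q≡x)))
    ... | no n₁ | no n₂ | no n₃ = contradiction (c q , q∈M , n₁ , n₂ , n₃) ¬fourth

    escape : ∀ {p q} → Triangle p → q ≡ a ⊎ q ≡ b → ¬ Adj G p q
    escape (inj₁ refl)        = typeI-x-avoids-singletons p₁ p₂ p₃ d₁₂ d₁₃ d₂₃ A B C _
    escape (inj₂ (inj₁ refl)) = typeI-x-avoids-singletons p₂ p₁ p₃ (λ e → d₁₂ (sym e)) d₂₃ d₁₃ B A C _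
    escape (inj₂ (inj₂ refl)) =
      typeI-x-avoids-singletons p₃ p₁ p₂ (λ e → d₁₃ (sym e)) (λ e → d₂₃ (sym e)) d₁₂ C A B _

    cases : Dec (∃[ R ] Fourth R) → ⊥
    cases (yes (R , pR , n₁ , n₂ , n₃)) =
      noTriangleSeeing R x₁ x₂ x₃ (λ e → n₁ (trans (sym e) cx₁)) (λ e → n₂ (trans (sym e) cx₂))
        (λ e → n₃ (trans (sym e) cx₃)) (x-adjacent p₁ p₂ d₁₂ A B) (x-adjacent p₁ p₃ d₁₃ A C)
        (x-adjacent p₂ p₃ d₂₃ B C) (x-sees R pR (λ e → n₁ (sym e)) A) (x-sees R pR (λ e → n₂ (sym e)) B)
        (x-sees R pR (λ e → n₃ (sym e)) C)
    cases (no ¬fourth) with leavingEdge Triangle Triangle? (connected x₁ a) (inj₁ refl) (λ t → a∉M (triangle⊆M t))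
    ... | p , q , tp , ¬tq , pq with M? q
    ...   | yes q∈M = isolated-nonadjacent′ (outside-isolated ¬fourth q q∈M ¬tq) (triangle⊆M tp) pq
    ...   | no q∉M  = escape tp (outsideM q q∉M) pq

  exactlyTwo : ExactlyTwo TypeI
  exactlyTwo with any? (λ i → any? (λ j → ¬? (i ≟ j) ×-dec (TypeI? i ×-dec TypeI? j)))
  ... | yes (i , j , i≢j , I , J) = i , j , i≢j , I , J , third
    where
    third : ∀ k → TypeI k → k ≡ i ⊎ k ≡ j
    third k K with k ≟ i | k ≟ j
    ... | yes e | _     = inj₁ e
    ... | no _  | yes e = inj₂ e
    ... | no k≢i | no k≢j = ⊥-elim (atMostTwo i≢j (λ e → k≢i (sym e)) (λ e → k≢j (sym e)) I J K)
  ... | no ¬two = ⊥-elim (atLeastTwo atMostOne)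
    where
    atMostOne : AtMostOneTypeI
    atMostOne i j I J with i ≟ j
    ... | yes e   = e
    ... | no i≢j = contradiction (i , j , i≢j , I , J) ¬two

lemma4 : (h : ℕ) → 4 ≤ h → (G : Graph) → Connected G →
    ChromaticNumber G 3 → GrundyNumber G 3 → AchromaticNumber G h →
    n G + 2 ≡ 2 * h →
    (c : Coloring G h) → IsComplete G c →
    (∀ i → classSize G c i ≡ 1 ⊎ classSize G c i ≡ 2) →
    ExactlyTwo (λ (i : Fin h) → classSize G c i ≡ 1) →
    ExactlyTwo (λ (i : Fin h) → classSize G c i ≡ 2 ×
                  ∃[ v ] (c v ≡ i × IsolatedInM G c v))
lemma4 h h≥4 G connected _ (_ , Γ≤3) _ _ c (proper , _ , complete) sizes
       (ia , ib , ia≢ib , size-ia , size-ib , onlySingletons) =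
  Setting.exactlyTwo G h h≥4 connected Γ≤3 c proper complete sizes ia ib ia≢ib size-ia size-ib onlySingletons
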